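{- For all integers $n\geqslant 2$ and $s\geqslant 0$, the $s$-jet graph $\mathcal{J}_s(K_{1,n})$ of the star $K_{1,n}$ is co-chordal.
   Context: $K_{1,n}$ is the complete bipartite graph with vertices $x_0,x_1,\dots,x_n$ and edges $\{x_0,x_i\}$ for $i=1,\dots,n$. For a simple graph $G$ with vertex set $\{y_1,\dots,y_m\}$ and $s\in\mathbb{N}$, the $s$-jet graph $\mathcal{J}_s(G)$ is the simple graph with vertex set $\{y_{i,j}\mid i=1,\dots,m,\ j=0,\dots,s\}$ in which $\{y_{i,j},y_{k,l}\}$ is an edge if and only if $\{y_i,y_k\}$ is an edge of $G$ and $j+l\leqslant s$. A graph is chordal if it has no induced cycle of length four or more; a graph is co-chordal if its complement is chordal. -}

module Defs where

open import Data.Nat using (ℕ; zero; suc; _+_; _≤_)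
open import Data.Fin using (Fin; toℕ)
open import Data.Product using (_×_; Σ; _,_)
open import Data.Sum using (_⊎_)
open import Relation.Nullary using (¬_)
open import Relation.Binary.PropositionalEquality using (_≡_; _≢_)
open import Function.Definitions using (Injective)

-- A graph on a vertex type V, given by its adjacency relation.
-- (All graphs below are simple: adjacency is symmetric and irreflexive.)
Graph : Set → Set₁
Graph V = V → V → Set

complement : {V : Set} → Graph V → Graph V
complement G u v = (u ≢ v) × ¬ G u v

CycAdj : (k : ℕ) → Fin k → Fin k → Set
CycAdj k i j =
  (suc (toℕ i) ≡ toℕ j) ⊎ (suc (toℕ j) ≡ toℕ i)
  ⊎ ((toℕ i ≡ 0) × (suc (toℕ j) ≡ k)) ⊎ ((toℕ j ≡ 0) × (suc (toℕ i) ≡ k))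

IsInducedCycle : {V : Set} → Graph V → (k : ℕ) → (Fin k → V) → Set
IsInducedCycle G k c =
  Injective _≡_ _≡_ c ×
  (∀ i j → (G (c i) (c j) → CycAdj k i j) × (CycAdj k i j → G (c i) (c j)))

Chordal : {V : Set} → Graph V → Set
Chordal G = ∀ k → 4 ≤ k → (c : Fin k → _) → ¬ IsInducedCycle G k c

CoChordal : {V : Set} → Graph V → Set
CoChordal G = Chordal (complement G)

Star : (n : ℕ) → Graph (Fin (suc n))
Star n a b = ((toℕ a ≡ 0) × (toℕ b ≢ 0)) ⊎ ((toℕ b ≡ 0) × (toℕ a ≢ 0))

Jet : {V : Set} → (s : ℕ) → Graph V → Graph (V × Fin (suc s))
Jet s G (a , j) (b , l) = G a b × (toℕ j + toℕ l ≤ s)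

-- Colour the vertices of J_s(K_{1,n}) by whether they lie over the centre x₀.
-- The jet graph is bipartite for this colouring, so in its complement H both
-- colour classes are cliques and every non-edge joins the two classes. Hence an
-- induced cycle of H has at most two vertices of each colour: cycles of length
-- ≥ 5 are impossible, and an induced 4-cycle consists of centres x₀,ᵢ, x₀,ⱼ
-- and leaves y, z with x₀,ⱼ ~ y, z ~ x₀,ᵢ in H but x₀,ᵢ ≁ y, x₀,ⱼ ≁ z. Across
-- the classes, H-adjacency is the threshold condition "jet orders sum to more
-- than s", and adding the four conditions gives s + s < s + s.
module Submission where

open import Defs
open import Data.Bool using (Bool; true; false; not)
open import Data.Bool.Properties using (¬-not)
open import Data.Empty using (⊥)
open import Data.Fin using (Fin; toℕ; zero; suc)
open import Data.Fin.Patterns using (0F; 1F; 2F; 3F; 4F)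
open import Data.Nat using (ℕ; zero; suc; _+_; _≤_; _<_; _≤?_; z≤n; s≤s)
open import Data.Nat.Properties
  using (≤-refl; ≤-reflexive; ≤-trans; n≤1+n; m≤m+n; 1+n≰n; n≮0; <-asym; ≰⇒>; +-mono-<; +-mono-≤; <-irrefl; module ≤-Reasoning)
open import Data.Nat.Tactic.RingSolver using (solve-∀)
open import Data.Product using (_×_; _,_; proj₁; proj₂)
open import Data.Sum using (inj₁; inj₂)
open import Function using (_∘_)
open import Relation.Nullary using (¬_)
open import Relation.Nullary.Decidable using (decidable-stable)
open import Relation.Binary.PropositionalEquality using (_≡_; _≢_; refl; sym; trans; cong; cong₂; ≢-sym)

CycAdj-sym : ∀ {k} {i j : Fin k} → CycAdj k i j → CycAdj k j i
CycAdj-sym (inj₁ p) = inj₂ (inj₁ p)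
CycAdj-sym (inj₂ (inj₁ p)) = inj₁ p
CycAdj-sym (inj₂ (inj₂ (inj₁ p))) = inj₂ (inj₂ (inj₂ p))
CycAdj-sym (inj₂ (inj₂ (inj₂ p))) = inj₂ (inj₂ (inj₁ p))

non-consecutive⇒¬CycAdj : ∀ {k} {i j : Fin k} →
  2 + toℕ i ≤ toℕ j → 2 + toℕ j ≤ toℕ i + k → ¬ CycAdj k i j
non-consecutive⇒¬CycAdj i+2≤j _ (inj₁ 1+i≡j) =
  1+n≰n (≤-trans i+2≤j (≤-reflexive (sym 1+i≡j)))
non-consecutive⇒¬CycAdj i+2≤j _ (inj₂ (inj₁ 1+j≡i)) =
  <-asym (≤-trans (n≤1+n _) i+2≤j) (≤-reflexive 1+j≡i)
non-consecutive⇒¬CycAdj {j = j} _ j+2≤i+k (inj₂ (inj₂ (inj₁ (i≡0 , 1+j≡k)))) =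
  1+n≰n (≤-trans j+2≤i+k (≤-reflexive (cong₂ _+_ i≡0 (sym 1+j≡k))))
non-consecutive⇒¬CycAdj i+2≤j _ (inj₂ (inj₂ (inj₂ (j≡0 , _)))) =
  n≮0 (≤-trans i+2≤j (≤-reflexive j≡0))

record InducedSquare {V : Set} (G : Graph V) (a b c d : V) : Set where
  field
    ab : G a b
    bc : G b c
    cd : G c d
    da : G d a
    ¬ac : ¬ G a c
    ¬ca : ¬ G c a
    ¬bd : ¬ G b d
    ¬db : ¬ G d b
    a≢c : a ≢ c
    b≢d : b ≢ d

module _ {V : Set} {G : Graph V} where

  rotate : ∀ {a b c d} → InducedSquare G a b c d → InducedSquare G b c d a
  rotate sq = record
    { ab = bc ; bc = cd ; cd = da ; da = ab
    ; ¬ac = ¬bd ; ¬ca = ¬db ; ¬bd = ¬ca ; ¬db = ¬ac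
    ; a≢c = b≢d ; b≢d = ≢-sym a≢c
    }
    where open InducedSquare sq

  inducedCycle⇒square : ∀ {c : Fin 4 → V} →
    IsInducedCycle G 4 c → InducedSquare G (c 0F) (c 1F) (c 2F) (c 3F)
  inducedCycle⇒square {c} (inj , cyc) = record
    { ab = edge (inj₁ refl)
    ; bc = edge (inj₁ refl)
    ; cd = edge (inj₁ refl)
    ; da = edge (inj₂ (inj₂ (inj₂ (refl , refl))))
    ; ¬ac = non-edge ¬adj02
    ; ¬ca = non-edge (¬adj02 ∘ CycAdj-sym)
    ; ¬bd = non-edge ¬adj13
    ; ¬db = non-edge (¬adj13 ∘ CycAdj-sym)
    ; a≢c = (λ ()) ∘ inj
    ; b≢d = (λ ()) ∘ inj
    }
    where
    edge : ∀ {i j} → CycAdj 4 i j → G (c i) (c j)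
    edge = proj₂ (cyc _ _)
    non-edge : ∀ {i j} → ¬ CycAdj 4 i j → ¬ G (c i) (c j)
    non-edge ¬adj = ¬adj ∘ proj₁ (cyc _ _)
    ¬adj02 : ¬ CycAdj 4 0F 2F
    ¬adj02 = non-consecutive⇒¬CycAdj ≤-refl ≤-refl
    ¬adj13 : ¬ CycAdj 4 1F 3F
    ¬adj13 = non-consecutive⇒¬CycAdj ≤-refl ≤-refl

≢-≢⇒≡ : ∀ {x y z : Bool} → x ≢ y → y ≢ z → x ≡ z
≢-≢⇒≡ x≢y y≢z = trans (¬-not x≢y) (sym (¬-not (≢-sym y≢z)))

module CoBipartite {V : Set} (G : Graph V) (χ : V → Bool)
  (non-edge⇒χ≢ : ∀ {u v} → u ≢ v → ¬ G u v → χ u ≢ χ v) where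

  no-long-inducedCycle : ∀ k (c : Fin (5 + k) → V) → ¬ IsInducedCycle G (5 + k) c
  no-long-inducedCycle k c (inj , cyc) =
    χ₁≢χ₄ (trans (sym (≢-≢⇒≡ χ₀≢χ₃ χ₃≢χ₁)) (≢-≢⇒≡ χ₀≢χ₂ χ₂≢χ₄))
    where
    chord⇒χ≢ : ∀ {i j} → i ≢ j → 2 + toℕ i ≤ toℕ j → 2 + toℕ j ≤ toℕ i + (5 + k) →
               χ (c i) ≢ χ (c j)
    chord⇒χ≢ i≢j i+2≤j j+2≤i+k =
      non-edge⇒χ≢ (i≢j ∘ inj) (non-consecutive⇒¬CycAdj i+2≤j j+2≤i+k ∘ proj₁ (cyc _ _))
    χ₀≢χ₂ : χ (c 0F) ≢ χ (c 2F)
    χ₀≢χ₂ = chord⇒χ≢ (λ ()) ≤-refl (m≤m+n 4 (suc k))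
    χ₀≢χ₃ : χ (c 0F) ≢ χ (c 3F)
    χ₀≢χ₃ = chord⇒χ≢ (λ ()) (n≤1+n 2) (m≤m+n 5 k)
    χ₃≢χ₁ : χ (c 3F) ≢ χ (c 1F)
    χ₃≢χ₁ = ≢-sym (chord⇒χ≢ (λ ()) ≤-refl (m≤m+n 5 (suc k)))
    χ₁≢χ₄ : χ (c 1F) ≢ χ (c 4F)
    χ₁≢χ₄ = chord⇒χ≢ (λ ()) (n≤1+n 3) (m≤m+n 6 k)
    χ₂≢χ₄ : χ (c 2F) ≢ χ (c 4F)
    χ₂≢χ₄ = chord⇒χ≢ (λ ()) ≤-refl (m≤m+n 6 (suc k))

  module _ {a b c d : V} (sq : InducedSquare G a b c d) where
    open InducedSquare sq

    χc≡not : ∀ {x} → χ a ≡ x → χ c ≡ not x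
    χc≡not χa≡x = trans (¬-not (≢-sym (non-edge⇒χ≢ a≢c ¬ac))) (cong not χa≡x)

    χd≡not : ∀ {x} → χ b ≡ x → χ d ≡ not x
    χd≡not χb≡x = trans (¬-not (≢-sym (non-edge⇒χ≢ b≢d ¬bd))) (cong not χb≡x)

  -- Both colour classes of an induced square are consecutive, so some rotation
  -- starts with its two true-coloured vertices.
  chordal : (∀ {a b c d} → InducedSquare G a b c d →
              χ a ≡ true → χ b ≡ true → χ c ≡ false → χ d ≡ false → ⊥) →
            Chordal G
  chordal no-square _ (s≤s (s≤s (s≤s (s≤s (z≤n {zero}))))) _ = no-inducedSquare ∘ inducedCycle⇒square
    where
    no-inducedSquare : ∀ {a b c d} → InducedSquare G a b c d → ⊥
    no-inducedSquare {a} {b} sq with χ a in χa | χ b in χb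
    ... | true  | true  = no-square sq χa χb (χc≡not sq χa) (χd≡not sq χb)
    ... | true  | false = no-square (rotate (rotate (rotate sq))) (χd≡not sq χb) χa χb (χc≡not sq χa)
    ... | false | true  = no-square (rotate sq) χb (χc≡not sq χa) (χd≡not sq χb) χa
    ... | false | false = no-square (rotate (rotate sq)) (χc≡not sq χa) (χd≡not sq χb) χa χb
  chordal _ _ (s≤s (s≤s (s≤s (s≤s (z≤n {suc k}))))) = no-long-inducedCycle k

complement-non-edge⇒χ≢ : ∀ {V : Set} {G : Graph V} {χ : V → Bool} →
  (∀ {u v} → G u v → χ u ≢ χ v) → ∀ {u v} → u ≢ v → ¬ complement G u v → χ u ≢ χ v
complement-non-edge⇒χ≢ edge⇒χ≢ u≢v ¬uv χu≡χv = ¬uv (u≢v , λ uv → edge⇒χ≢ uv χu≡χv)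

Jet-edge⇒χ≢ : ∀ {V : Set} {G : Graph V} {χ : V → Bool} {s} →
  (∀ {a b} → G a b → χ a ≢ χ b) → ∀ {u v} → Jet s G u v → χ (proj₁ u) ≢ χ (proj₁ v)
Jet-edge⇒χ≢ edge⇒χ≢ (ab , _) = edge⇒χ≢ ab

complement-Jet⇒s< : ∀ {V : Set} (G : Graph V) {s a b} {j l : Fin (suc s)} →
  G a b → complement (Jet s G) (a , j) (b , l) → s < toℕ j + toℕ l
complement-Jet⇒s< _ ab (_ , ¬jet) = ≰⇒> (λ j+l≤s → ¬jet (ab , j+l≤s))

¬complement-Jet⇒≤s : ∀ {V : Set} (G : Graph V) {s a b} {j l : Fin (suc s)} →
  G a b → (a , j) ≢ (b , l) → ¬ complement (Jet s G) (a , j) (b , l) → toℕ j + toℕ l ≤ s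
¬complement-Jet⇒≤s _ ab aj≢bl ¬c = decidable-stable (_ ≤? _)
  (λ j+l≰s → ¬c (aj≢bl , λ (_ , j+l≤s) → j+l≰s j+l≤s))

-- The bipartite graph "i ~ k iff i + k > s" has no induced 2K₂.
threshold-no-crossing : ∀ {s} i j k l → s < j + k → s < l + i → i + k ≤ s → j + l ≤ s → ⊥
threshold-no-crossing {s} i j k l s<j+k s<l+i i+k≤s j+l≤s = <-irrefl refl (begin-strict
  s + s             <⟨ +-mono-< s<j+k s<l+i ⟩
  (j + k) + (l + i) ≡⟨ rearrange i j k l ⟩
  (i + k) + (j + l) ≤⟨ +-mono-≤ i+k≤s j+l≤s ⟩
  s + s             ∎)
  where
  open ≤-Reasoning
  rearrange : ∀ i j k l → (j + k) + (l + i) ≡ (i + k) + (j + l)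
  rearrange = solve-∀

isCentre : ∀ {n} → Fin (suc n) → Bool
isCentre zero = true
isCentre (suc _) = false

Star-edge⇒isCentre≢ : ∀ {n} {a b : Fin (suc n)} → Star n a b → isCentre a ≢ isCentre b
Star-edge⇒isCentre≢ {a = zero} {zero} (inj₁ (_ , 0≢0)) _ = 0≢0 refl
Star-edge⇒isCentre≢ {a = zero} {zero} (inj₂ (_ , 0≢0)) _ = 0≢0 refl
Star-edge⇒isCentre≢ {a = suc _} {suc _} (inj₁ (() , _))
Star-edge⇒isCentre≢ {a = suc _} {suc _} (inj₂ (() , _))
Star-edge⇒isCentre≢ {a = zero} {suc _} _ ()
Star-edge⇒isCentre≢ {a = suc _} {zero} _ ()

module _ {n s : ℕ} where

  private
    H : Graph (Fin (suc n) × Fin (suc s))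
    H = complement (Jet s (Star n))

  non-edge⇒isCentre≢ : ∀ {u v} → u ≢ v → ¬ H u v → isCentre (proj₁ u) ≢ isCentre (proj₁ v)
  non-edge⇒isCentre≢ = complement-non-edge⇒χ≢
    (λ {u} {v} → Jet-edge⇒χ≢ {χ = isCentre} Star-edge⇒isCentre≢ {u} {v})

  no-threshold-square : ∀ {p q : Fin n} {i j k l : Fin (suc s)} →
    InducedSquare H (zero , i) (zero , j) (suc p , k) (suc q , l) → ⊥
  no-threshold-square {i = i} {j} {k} {l} sq = threshold-no-crossing (toℕ i) (toℕ j) (toℕ k) (toℕ l)
    (complement-Jet⇒s< (Star n) centre-leaf bc) (complement-Jet⇒s< (Star n) leaf-centre da)
    (¬complement-Jet⇒≤s (Star n) centre-leaf (λ ()) ¬ac)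
    (¬complement-Jet⇒≤s (Star n) centre-leaf (λ ()) ¬bd)
    where
    open InducedSquare sq
    centre-leaf : ∀ {p} → Star n zero (suc p)
    centre-leaf = inj₁ (refl , λ ())
    leaf-centre : ∀ {p} → Star n (suc p) zero
    leaf-centre = inj₂ (refl , λ ())

  no-coloured-square : ∀ {a b c d} → InducedSquare H a b c d →
    isCentre (proj₁ a) ≡ true → isCentre (proj₁ b) ≡ true →
    isCentre (proj₁ c) ≡ false → isCentre (proj₁ d) ≡ false → ⊥
  no-coloured-square {zero , _} {zero , _} {suc _ , _} {suc _ , _} sq _ _ _ _ = no-threshold-square sq
  no-coloured-square {suc _ , _} _ ()
  no-coloured-square {_} {suc _ , _} _ _ ()
  no-coloured-square {_} {_} {zero , _} _ _ _ ()
  no-coloured-square {_} {_} {_} {zero , _} _ _ _ _ ()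

-- The proof does not need n ≥ 2.
proposition2 : ∀ (n s : ℕ) → 2 ≤ n → CoChordal (Jet s (Star n))
proposition2 n s _ = chordal no-coloured-square
  where
  open CoBipartite (complement (Jet s (Star n))) (isCentre ∘ proj₁) non-edge⇒isCentre≢
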